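{- Let $r\ge1$ and consider the binary flag of order $r$ and its cells. Then: (a) for every cell $C$, $|C|=2^{|g(C)|}$; (b) for every $i$-genotype $g$ ($0\le i\le r$), there are exactly $(2^{2^{r-i}}-2)^{2^i-|g|}$ cells $C$ at level $i$ with $g(C)=g$; (c) if $C$ is a cell at level $i\ge1$ with $g(C)=g$ and $C'$ is a child of $C$, then $g(C')\subseteq g^*$; in particular $|g(C')|\le\frac12|g(C)|$; (d) if $C$ is a cell at level $i\ge1$ with $g(C)=g$ and $g'$ is an $(i-1)$-genotype with $g'\subseteq g^*$, then the number of children $C'$ of $C$ with $g(C')=g'$ is $2^{|g|-|g^*|-|g'|}$; (e) if $C$ is a cell at level $i\ge1$ with $g(C)=g$, then $C$ has exactly $2^{|g|-2|g^*|}3^{|g^*|}$ children.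
   Context: Index the coordinates of $\mathbb{Q}^{\mathcal{P}[r]}$ by subsets $S\subseteq[r]$. For $0\le i\le r$ let $V_i=\{x: x_S=x_{S\cap[i]}\ \forall S\subseteq[r]\}$. A cell at level $i$ is a set $(x+V_i)\cap\{0,1\}^{\mathcal{P}[r]}$ with $x\in\{0,1\}^{\mathcal{P}[r]}$; for $i\ge1$ each cell at level $i$ is a disjoint union of cells at level $i-1$, its children. For $\omega\in\{0,1\}^{\mathcal{P}[r]}$ and $A\subseteq[i]$, the $i$-block of $\omega$ at $A$ is the tuple $\omega(A,i)=(\omega_{A\cup A'})_{A'\subseteq\{i+1,\dots,r\}}$; it is constant if all its entries are equal. An $i$-genotype is any subset of $\mathcal{P}[i]$. The genotype $g(C)$ of a cell $C$ at level $i$ is the set of $A\subseteq[i]$ for which $\omega(A,i)$ is constant, for any $\omega\in C$ (this does not depend on the choice of $\omega$). For an $i$-genotype $g$ ($i\ge1$), its consolidation is the $(i-1)$-genotype $g^*=\{A'\subseteq[i-1]: A'\in g\text{ and }A'\cup\{i\}\in g\}$. -}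

module Defs where

open import Data.Nat using (ℕ; zero; suc; _+_; _≤_; z≤n; s≤s)
open import Data.Bool using (Bool; true; false; if_then_else_; _∧_)
open import Data.Integer using (ℤ; _-_; 0ℤ; 1ℤ)
open import Data.Fin using (Fin)
open import Data.Fin.Subset using (Subset; ⊥; _∪_)
open import Data.Vec using (Vec; []; _∷_; replicate; _∷ʳ_)
open import Data.Product using (Σ; _×_)
open import Relation.Binary.PropositionalEquality using (_≡_)

-- Subsets S ⊆ [r] = {1,…,r} are 'Subset r' (Vec Bool r); coordinate k : Fin r
-- stands for the element k+1 of [r].  Hence [i] (for i ≤ r) is the prefix of the
-- first i coordinates, and subsets of [i] are 'Subset i'.

-- A binary vector in {0,1}^{P[r]}, coordinates indexed by subsets of [r].
Word : ℕ → Set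
Word r = Subset r → Bool

toℤ : Bool → ℤ
toℤ false = 0ℤ
toℤ true  = 1ℤ

embed : ∀ {i r} → i ≤ r → Subset i → Subset r
embed z≤n     []      = replicate _ false
embed (s≤s p) (b ∷ A) = b ∷ embed p A

restrict : ∀ {i r} → i ≤ r → Subset r → Subset i
restrict z≤n     S       = []
restrict (s≤s p) (b ∷ S) = b ∷ restrict p S

meet : ∀ {i r} → i ≤ r → Subset r → Subset r
meet p S = embed p (restrict p S)

InV : ∀ {i r} → i ≤ r → (Subset r → ℤ) → Set
InV p v = ∀ S → v S ≡ v (meet p S)

-- ω ∈ (x + V_i) ∩ {0,1}^{P[r]}, i.e. ω lies in the level-i cell of x.
InCell : ∀ {i r} → i ≤ r → Word r → Word r → Set
InCell p x ω = InV p (λ S → toℤ (ω S) - toℤ (x S))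

SameCell : ∀ {i r} → i ≤ r → Word r → Word r → Set
SameCell p x y = ∀ ω → (InCell p x ω → InCell p y ω) × (InCell p y ω → InCell p x ω)

-- The level-j cell of y is contained in the level-i cell of x
-- (used for: the level-(i-1) cell of y is a child of the level-i cell of x).
IsChild : ∀ {i j r} → i ≤ r → j ≤ r → Word r → Word r → Set
IsChild p q x y = ∀ ω → InCell q y ω → InCell p x ω

Above : ∀ {i r} → i ≤ r → Subset r → Set
Above p A' = restrict p A' ≡ ⊥

BlockConst : ∀ {i r} → i ≤ r → Word r → Subset i → Set
BlockConst p ω A = ∀ A' A'' → Above p A' → Above p A'' →
  ω (embed p A ∪ A') ≡ ω (embed p A ∪ A'')

Genotype : ℕ → Set
Genotype i = Subset i → Bool

-- g(C) = g for the level-i cell C containing x.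
HasGeno : ∀ {i r} → i ≤ r → Word r → Genotype i → Set
HasGeno p x g = ∀ A → (g A ≡ true → BlockConst p x A) × (BlockConst p x A → g A ≡ true)

card : ∀ {n} → (Subset n → Bool) → ℕ
card {zero}  g = if g [] then 1 else 0
card {suc n} g = card (λ A → g (false ∷ A)) + card (λ A → g (true ∷ A))

consol : ∀ {j} → Genotype (suc j) → Genotype j
consol g A' = g (A' ∷ʳ false) ∧ g (A' ∷ʳ true)

_⊆g_ : ∀ {i} → Genotype i → Genotype i → Set
g' ⊆g g = ∀ A → g' A ≡ true → g A ≡ true

HasCount : {A : Set} → (A → A → Set) → (A → Set) → ℕ → Set
HasCount {A} _≈_ P n =
  Σ (Fin n → A) λ v →
    (∀ k → P (v k)) ×
    (∀ k l → v k ≈ v l → k ≡ l) ×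
    (∀ a → P a → Σ (Fin n) λ k → a ≈ v k)

{-# OPTIONS --safe #-}
-- Sorting the subsets of [r] by whether they contain 1 splits a word over P[r] into two halves,
-- words over P{2,…,r}.  A level-(i+1) cell of a word is the product of the level-i cells of its
-- halves, and its genotype is the disjoint union of theirs.  Unfolding i times, a level-i cell
-- is a product over A ⊆ [i] of level-0 cells of the blocks ω(A,i), and a level-0 cell is either
-- a single non-constant word or the pair of constant words, the genotype recording which.  All
-- counts are therefore multiplicative: the level-0 factors are 2 or 1 (part (a)), and 1 or the
-- number 2^{2^{r-i}} - 2 of non-constant words (part (b)).  Likewise the children of a
-- level-(j+1) cell are a product over A ⊆ [j] of children of level-1 cells, so for (c)–(e) it
-- remains to inspect a level-1 cell: unless both halves are constant, its children are its
-- words, each forming its own level-0 cell; if both halves are constant there are three, the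
-- constant cell and the two words with distinct constant halves.
module Submission where

open import Defs
open import Algebra.Properties.CommutativeSemigroup using (interchange)
open import Data.Bool using (Bool; true; false; not; if_then_else_; _∧_)
open import Data.Bool.Properties using (_≟_; ∨-identityʳ; ∧-conicalˡ; ∧-conicalʳ; ¬-not; not-¬)
open import Data.Empty using (⊥-elim)
open import Data.Fin using (Fin)
open import Data.Fin.Properties using (*↔×; +↔⊎; 1↔⊤; 2↔Bool)
open import Data.Fin.Subset using (Subset; ⊥; _∪_)
open import Data.Fin.Subset.Properties using (∪-identityˡ)
open import Data.Integer using (ℤ; _-_; 0ℤ; 1ℤ; -1ℤ)
open import Data.Nat using (ℕ; zero; suc; _+_; _*_; _^_; _∸_; _≤_; z≤n; s≤s)
open import Data.Nat.Properties
  using (*-identityʳ; +-identityʳ; ^-distribˡ-+-*; *-distribˡ-+; +-∸-assoc; +-mono-≤; *-monoʳ-≤;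
         ^-monoʳ-≤; m^n>0; ≤-refl; ≤-trans; m≤m+n; m+n≤o⇒m≤o∸n; *-commutativeSemigroup)
open import Data.Nat.Tactic.RingSolver using (solve-∀)
open import Data.Product using (Σ; _×_; _,_; proj₁; proj₂)
open import Data.Sum using (_⊎_; inj₁; inj₂; [_,_])
open import Data.Unit using (⊤; tt)
open import Data.Vec using ([]; _∷_)
open import Data.Vec.Properties using (∷-injectiveˡ; ∷-injectiveʳ)
open import Function using (const; _$_; _↔_; Inverse)
open import Relation.Binary.Definitions using (Symmetric)
open import Relation.Binary.PropositionalEquality
  using (_≡_; _≢_; refl; sym; trans; cong; cong₂; subst; subst₂; _≗_; module ≡-Reasoning)
open import Relation.Nullary using (¬_; Dec; yes; no)

open ≡-Reasoning

-- Counting up to an equivalence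

record Enumeration (I : Set) {A : Set} (_≈_ : A → A → Set) (P : A → Set) : Set where
  constructor enumeration
  field
    at       : I → A
    at-P     : ∀ i → P (at i)
    at-inj   : ∀ i j → at i ≈ at j → i ≡ j
    at-cover : ∀ a → P a → Σ I λ i → a ≈ at i

-- HasCount with the fields packed in a record, so that _≈_ and P can be inferred.
Count : {A : Set} → (A → A → Set) → (A → Set) → ℕ → Set
Count _≈_ P n = Enumeration (Fin n) _≈_ P

Count⇒HasCount : ∀ {A : Set} {_≈_ : A → A → Set} {P : A → Set} {n} → Count _≈_ P n → HasCount _≈_ P n
Count⇒HasCount (enumeration v Pv v-inj v-cover) = v , Pv , v-inj , v-cover

module _ {A : Set} {_≈_ : A → A → Set} where

  Enumeration-reindex : ∀ {I J : Set} {P : A → Set} → J ↔ I → Enumeration I _≈_ P → Enumeration J _≈_ P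
  Enumeration-reindex J↔I (enumeration v Pv v-inj v-cover) = enumeration
    (λ j → v (to j))
    (λ j → Pv (to j))
    (λ j j' e → trans (sym (strictlyInverseʳ j)) (trans (cong from (v-inj _ _ e)) (strictlyInverseʳ j')))
    λ a Pa → let i , a≈vi = v-cover a Pa in
      from i , subst (λ i' → a ≈ v i') (sym (strictlyInverseˡ i)) a≈vi
    where open Inverse J↔I

  Enumeration-⊎ : ∀ {I J : Set} {P P₁ P₂ : A → Set} → Symmetric _≈_ →
    (∀ {a} → P a → P₁ a ⊎ P₂ a) → (∀ {a} → P₁ a → P a) → (∀ {a} → P₂ a → P a) →
    (∀ {a b} → P₁ a → P₂ b → ¬ (a ≈ b)) →
    Enumeration I _≈_ P₁ → Enumeration J _≈_ P₂ → Enumeration (I ⊎ J) _≈_ P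
  Enumeration-⊎ {I} {J} {P} ≈-sym split P₁⇒P P₂⇒P disjoint
    (enumeration v₁ P₁v₁ v₁-inj v₁-cover) (enumeration v₂ P₂v₂ v₂-inj v₂-cover) =
    enumeration [ v₁ , v₂ ] Pv v-inj v-cover
    where
    Pv : ∀ s → P ([ v₁ , v₂ ] s)
    Pv (inj₁ i) = P₁⇒P (P₁v₁ i)
    Pv (inj₂ j) = P₂⇒P (P₂v₂ j)
    v-inj : ∀ s t → [ v₁ , v₂ ] s ≈ [ v₁ , v₂ ] t → s ≡ t
    v-inj (inj₁ i) (inj₁ i') e = cong inj₁ (v₁-inj i i' e)
    v-inj (inj₁ i) (inj₂ j)  e = ⊥-elim (disjoint (P₁v₁ i) (P₂v₂ j) e)
    v-inj (inj₂ j) (inj₁ i)  e = ⊥-elim (disjoint (P₁v₁ i) (P₂v₂ j) (≈-sym e))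
    v-inj (inj₂ j) (inj₂ j') e = cong inj₂ (v₂-inj j j' e)
    v-cover : ∀ a → P a → Σ (I ⊎ J) λ s → a ≈ [ v₁ , v₂ ] s
    v-cover a Pa with split Pa
    ... | inj₁ P₁a = let i , e = v₁-cover a P₁a in inj₁ i , e
    ... | inj₂ P₂a = let j , e = v₂-cover a P₂a in inj₂ j , e

  Count-cast : ∀ {P : A → Set} {m n} → m ≡ n → Count _≈_ P m → Count _≈_ P n
  Count-cast refl c = c

  Count-0 : ∀ {P : A → Set} → (∀ {a} → ¬ P a) → Count _≈_ P 0
  Count-0 ¬P = enumeration (λ ()) (λ ()) (λ ()) λ a Pa → ⊥-elim (¬P Pa)

  Count-1 : ∀ {P : A → Set} a → P a → (∀ {b} → P b → b ≈ a) → Count _≈_ P 1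
  Count-1 a Pa cover =
    Enumeration-reindex 1↔⊤ (enumeration (λ _ → a) (λ _ → Pa) (λ _ _ _ → refl) λ b Pb → tt , cover Pb)

  Count-2 : ∀ {P : A → Set} → Enumeration Bool _≈_ P → Count _≈_ P 2
  Count-2 = Enumeration-reindex 2↔Bool

  Count-+ : ∀ {P P₁ P₂ : A → Set} → Symmetric _≈_ →
    (∀ {a} → P a → P₁ a ⊎ P₂ a) → (∀ {a} → P₁ a → P a) → (∀ {a} → P₂ a → P a) →
    (∀ {a b} → P₁ a → P₂ b → ¬ (a ≈ b)) →
    ∀ {m n} → Count _≈_ P₁ m → Count _≈_ P₂ n → Count _≈_ P (m + n)
  Count-+ ≈-sym split P₁⇒P P₂⇒P disjoint c₁ c₂ =
    Enumeration-reindex +↔⊎ (Enumeration-⊎ ≈-sym split P₁⇒P P₂⇒P disjoint c₁ c₂)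

Count-cong : ∀ {A : Set} {_≈_ _≈'_ : A → A → Set} {P P' : A → Set} →
  (∀ {a} → P' a → P a) → (∀ {a} → P a → P' a) →
  (∀ {a b} → P a → P b → a ≈ b → a ≈' b) → (∀ {a b} → P a → P b → a ≈' b → a ≈ b) →
  ∀ {n} → Count _≈_ P n → Count _≈'_ P' n
Count-cong P'⇒P P⇒P' ≈⇒≈' ≈'⇒≈ (enumeration v Pv v-inj v-cover) = enumeration
  v (λ k → P⇒P' (Pv k)) (λ k l e → v-inj k l (≈'⇒≈ (Pv k) (Pv l) e))
  λ a P'a → let k , a≈vk = v-cover a (P'⇒P P'a) in k , ≈⇒≈' (P'⇒P P'a) (Pv k) a≈vk

Count-cong-pred : ∀ {A : Set} {_≈_ : A → A → Set} {P P' : A → Set} →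
  (∀ {a} → P' a → P a) → (∀ {a} → P a → P' a) → ∀ {n} → Count _≈_ P n → Count _≈_ P' n
Count-cong-pred P'⇒P P⇒P' = Count-cong P'⇒P P⇒P' (λ _ _ e → e) (λ _ _ e → e)

-- Words and their halves

half : ∀ {r} → Bool → Word (suc r) → Word r
half b w S = w (b ∷ S)

glue : ∀ {r} → Word r → Word r → Word (suc r)
glue w₀ w₁ (false ∷ S) = w₀ S
glue w₀ w₁ (true  ∷ S) = w₁ S

Enumeration-glue : ∀ {r} {I J : Set}
  {_≈_ : Word (suc r) → Word (suc r) → Set} {_≈'_ : Word r → Word r → Set}
  {P : Word (suc r) → Set} {P₀ P₁ : Word r → Set} →
  (∀ {a b} → a ≈ b → half false a ≈' half false b × half true a ≈' half true b) →
  (∀ {a b} → half false a ≈' half false b → half true a ≈' half true b → a ≈ b) →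
  (∀ {a} → P a → P₀ (half false a) × P₁ (half true a)) →
  (∀ {a₀ a₁} → P₀ a₀ → P₁ a₁ → P (glue a₀ a₁)) →
  Enumeration I _≈'_ P₀ → Enumeration J _≈'_ P₁ → Enumeration (I × J) _≈_ P
Enumeration-glue ≈⇒halves halves⇒≈ P⇒halves halves⇒P
  (enumeration v₀ P₀v₀ v₀-inj v₀-cover) (enumeration v₁ P₁v₁ v₁-inj v₁-cover) = enumeration
  (λ (i , j) → glue (v₀ i) (v₁ j))
  (λ (i , j) → halves⇒P (P₀v₀ i) (P₁v₁ j))
  (λ (i , j) (i' , j') e → let e₀ , e₁ = ≈⇒halves e in cong₂ _,_ (v₀-inj i i' e₀) (v₁-inj j j' e₁))
  λ a Pa → let P₀a , P₁a = P⇒halves Pa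
               i , e₀ = v₀-cover _ P₀a
               j , e₁ = v₁-cover _ P₁a
           in (i , j) , halves⇒≈ e₀ e₁

Count-glue : ∀ {r}
  {_≈_ : Word (suc r) → Word (suc r) → Set} {_≈'_ : Word r → Word r → Set}
  {P : Word (suc r) → Set} {P₀ P₁ : Word r → Set} →
  (∀ {a b} → a ≈ b → half false a ≈' half false b × half true a ≈' half true b) →
  (∀ {a b} → half false a ≈' half false b → half true a ≈' half true b → a ≈ b) →
  (∀ {a} → P a → P₀ (half false a) × P₁ (half true a)) →
  (∀ {a₀ a₁} → P₀ a₀ → P₁ a₁ → P (glue a₀ a₁)) →
  ∀ {n₀ n₁} → Count _≈'_ P₀ n₀ → Count _≈'_ P₁ n₁ → Count _≈_ P (n₀ * n₁)
Count-glue ≈⇒halves halves⇒≈ P⇒halves halves⇒P c₀ c₁ =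
  Enumeration-reindex *↔× (Enumeration-glue ≈⇒halves halves⇒≈ P⇒halves halves⇒P c₀ c₁)

false≢true : false ≢ true
false≢true ()

≗-sym : ∀ {r} {a b : Word r} → a ≗ b → b ≗ a
≗-sym e S = sym (e S)

≗⇒halves≗ : ∀ {r} {a b : Word (suc r)} → a ≗ b → half false a ≗ half false b × half true a ≗ half true b
≗⇒halves≗ e = (λ S → e (false ∷ S)) , (λ S → e (true ∷ S))

halves≗⇒≗ : ∀ {r} {a b : Word (suc r)} → half false a ≗ half false b → half true a ≗ half true b → a ≗ b
halves≗⇒≗ e₀ e₁ (false ∷ S) = e₀ S
halves≗⇒≗ e₀ e₁ (true  ∷ S) = e₁ S

∀-Subset? : ∀ {r} {P : Subset r → Set} → (∀ S → Dec (P S)) → Dec (∀ S → P S)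
∀-Subset? {zero} P? with P? []
... | yes p = yes λ { [] → p }
... | no ¬p = no λ ∀P → ¬p (∀P [])
∀-Subset? {suc r} P? with ∀-Subset? (λ S → P? (false ∷ S)) | ∀-Subset? (λ S → P? (true ∷ S))
... | yes p₀ | yes p₁ = yes λ { (false ∷ S) → p₀ S ; (true ∷ S) → p₁ S }
... | no ¬p₀ | _      = no λ ∀P → ¬p₀ (λ S → ∀P (false ∷ S))
... | yes _  | no ¬p₁ = no λ ∀P → ¬p₁ (λ S → ∀P (true ∷ S))

Const : ∀ {r} → Word r → Set
Const w = ∀ S → w S ≡ w ⊥

Const? : ∀ {r} (w : Word r) → Dec (Const w)
Const? w = ∀-Subset? (λ S → w S ≟ w ⊥)

Const-resp-≗ : ∀ {r} {a b : Word r} → a ≗ b → Const b → Const a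
Const-resp-≗ e c S = trans (e S) (trans (c S) (sym (e ⊥)))

Const-half : ∀ {r} b {w : Word (suc r)} → Const w → Const (half b w)
Const-half b c S = trans (c (b ∷ S)) (sym (c (b ∷ ⊥)))

Const-halves : ∀ {r} {w : Word (suc r)} → Const (half false w) → Const (half true w) →
  w (false ∷ ⊥) ≡ w (true ∷ ⊥) → Const w
Const-halves c₀ c₁ e (false ∷ S) = c₀ S
Const-halves c₀ c₁ e (true  ∷ S) = trans (c₁ S) (sym e)

-- Cells and genotypes

-- Cell p y is the level-i cell of y and Geno p y g says that g is its genotype, both defined
-- by splitting into halves i times instead of through V_i and the i-blocks.
Cell : ∀ {i r} → i ≤ r → Word r → Word r → Set
Cell z≤n     y w = (w ≗ y) ⊎ (Const y × Const w)
Cell (s≤s p) y w = Cell p (half false y) (half false w) × Cell p (half true y) (half true w)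

Geno : ∀ {i r} → i ≤ r → Word r → Genotype i → Set
Geno z≤n     x g = (g [] ≡ true → Const x) × (Const x → g [] ≡ true)
Geno (s≤s p) x g = Geno p (half false x) (half false g) × Geno p (half true x) (half true g)

Cell-refl : ∀ {i r} (p : i ≤ r) y → Cell p y y
Cell-refl z≤n     y = inj₁ λ _ → refl
Cell-refl (s≤s p) y = Cell-refl p _ , Cell-refl p _

Cell-sym : ∀ {i r} (p : i ≤ r) {y w} → Cell p y w → Cell p w y
Cell-sym z≤n     (inj₁ e)         = inj₁ (≗-sym e)
Cell-sym z≤n     (inj₂ (cy , cw)) = inj₂ (cw , cy)
Cell-sym (s≤s p) (c₀ , c₁)        = Cell-sym p c₀ , Cell-sym p c₁

Cell₀-Const : ∀ {r} {y w : Word r} → Cell z≤n y w → Const y → Const w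
Cell₀-Const (inj₁ e)        cy = Const-resp-≗ e cy
Cell₀-Const (inj₂ (_ , cw)) _  = cw

Cell₀-¬Const : ∀ {r} {y w : Word r} → ¬ Const y → Cell z≤n y w → w ≗ y
Cell₀-¬Const ¬cy (inj₁ e)        = e
Cell₀-¬Const ¬cy (inj₂ (cy , _)) = ⊥-elim (¬cy cy)

Cell-trans : ∀ {i r} (p : i ≤ r) {y w u} → Cell p y w → Cell p w u → Cell p y u
Cell-trans z≤n (inj₁ e₁) (inj₁ e₂)        = inj₁ λ S → trans (e₂ S) (e₁ S)
Cell-trans z≤n (inj₁ e)  (inj₂ (cw , cu)) = inj₂ (Const-resp-≗ (≗-sym e) cw , cu)
Cell-trans z≤n (inj₂ (cy , cw)) c         = inj₂ (cy , Cell₀-Const c cw)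
Cell-trans (s≤s p) (c₀ , c₁) (d₀ , d₁)    = Cell-trans p c₀ d₀ , Cell-trans p c₁ d₁

Cell-lift : ∀ {j r} (p : suc j ≤ r) (q : j ≤ r) {y w} → Cell q y w → Cell p y w
Cell-lift (s≤s z≤n) z≤n (inj₁ e) = inj₁ (proj₁ (≗⇒halves≗ e)) , inj₁ (proj₂ (≗⇒halves≗ e))
Cell-lift (s≤s z≤n) z≤n (inj₂ (cy , cw)) =
  inj₂ (Const-half false cy , Const-half false cw) , inj₂ (Const-half true cy , Const-half true cw)
Cell-lift (s≤s p) (s≤s q) (c₀ , c₁) = Cell-lift p q c₀ , Cell-lift p q c₁

diff : Bool → Bool → ℤ
diff a b = toℤ a - toℤ b

diff-self : ∀ a → diff a a ≡ 0ℤ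
diff-self false = refl
diff-self true  = refl

diff≡0 : ∀ a b → diff a b ≡ 0ℤ → a ≡ b
diff≡0 false false _ = refl
diff≡0 true  true  _ = refl
diff≡0 false true  ()
diff≡0 true  false ()

diff≡1 : ∀ a b → diff a b ≡ 1ℤ → a ≡ true × b ≡ false
diff≡1 true  false _  = refl , refl
diff≡1 false false ()
diff≡1 false true  ()
diff≡1 true  true  ()

diff≡-1 : ∀ a b → diff a b ≡ -1ℤ → a ≡ false × b ≡ true
diff≡-1 false true  _  = refl , refl
diff≡-1 false false ()
diff≡-1 true  false ()
diff≡-1 true  true  ()

InCell⇒Cell : ∀ {i r} (p : i ≤ r) x ω → InCell p x ω → Cell p x ω
InCell⇒Cell (s≤s p) x ω h =
  InCell⇒Cell p _ _ (λ S → h (false ∷ S)) , InCell⇒Cell p _ _ (λ S → h (true ∷ S))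
InCell⇒Cell z≤n x ω h with ω ⊥ | x ⊥
... | false | false = inj₁ λ S → diff≡0 _ _ (h S)
... | true  | true  = inj₁ λ S → diff≡0 _ _ (h S)
... | true  | false = inj₂ ((λ S → proj₂ (diff≡1 (ω S) (x S) (h S))) ,
                              (λ S → proj₁ (diff≡1 (ω S) (x S) (h S))))
... | false | true  = inj₂ ((λ S → proj₂ (diff≡-1 (ω S) (x S) (h S))) ,
                              (λ S → proj₁ (diff≡-1 (ω S) (x S) (h S))))

Cell⇒InCell : ∀ {i r} (p : i ≤ r) x ω → Cell p x ω → InCell p x ω
Cell⇒InCell (s≤s p) x ω (c₀ , c₁) (false ∷ S) = Cell⇒InCell p _ _ c₀ S
Cell⇒InCell (s≤s p) x ω (c₀ , c₁) (true  ∷ S) = Cell⇒InCell p _ _ c₁ S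
Cell⇒InCell z≤n x ω (inj₁ e) S rewrite e S | e ⊥ = trans (diff-self (x S)) (sym (diff-self (x ⊥)))
Cell⇒InCell z≤n x ω (inj₂ (cx , cω)) S = cong₂ diff (cω S) (cx S)

SameCell⇒Cell : ∀ {i r} (p : i ≤ r) {x y} → SameCell p x y → Cell p x y
SameCell⇒Cell p {x} {y} h = InCell⇒Cell p x y (proj₂ (h y) (Cell⇒InCell p y y (Cell-refl p y)))

Cell⇒SameCell : ∀ {i r} (p : i ≤ r) {x y} → Cell p x y → SameCell p x y
Cell⇒SameCell p {x} {y} c ω =
  (λ h → Cell⇒InCell p y ω (Cell-trans p (Cell-sym p c) (InCell⇒Cell p x ω h))) ,
  (λ h → Cell⇒InCell p x ω (Cell-trans p c (InCell⇒Cell p y ω h)))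

IsChild⇒Cell : ∀ {j r} (p : suc j ≤ r) (q : j ≤ r) {x y} → IsChild p q x y → Cell p x y
IsChild⇒Cell p q {x} {y} h = InCell⇒Cell p x y (h y (Cell⇒InCell q y y (Cell-refl q y)))

Cell⇒IsChild : ∀ {j r} (p : suc j ≤ r) (q : j ≤ r) {x y} → Cell p x y → IsChild p q x y
Cell⇒IsChild p q {x} {y} c ω h = Cell⇒InCell p x ω (Cell-trans p c (Cell-lift p q (InCell⇒Cell q y ω h)))

BlockConst⇒Const : ∀ {r} {x : Word r} → BlockConst z≤n x [] → Const x
BlockConst⇒Const {x = x} bc S =
  subst₂ (λ u v → x u ≡ x v) (∪-identityˡ S) (∪-identityˡ ⊥) (bc S ⊥ refl refl)

Const⇒BlockConst : ∀ {r} {x : Word r} → Const x → BlockConst z≤n x []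
Const⇒BlockConst {x = x} c A' A'' _ _ =
  trans (cong x (∪-identityˡ A')) (trans (c A') (sym (trans (cong x (∪-identityˡ A'')) (c A''))))

BlockConst-half⁻ : ∀ {i r} (p : i ≤ r) (x : Word (suc r)) b {A} →
  BlockConst (s≤s p) x (b ∷ A) → BlockConst p (half b x) A
BlockConst-half⁻ p x b {A} bc A' A'' h h' =
  subst (λ c → x (c ∷ (embed p A ∪ A')) ≡ x (c ∷ (embed p A ∪ A''))) (∨-identityʳ b)
    (bc (false ∷ A') (false ∷ A'') (cong (false ∷_) h) (cong (false ∷_) h'))

BlockConst-half⁺ : ∀ {i r} (p : i ≤ r) (x : Word (suc r)) b {A} →
  BlockConst p (half b x) A → BlockConst (s≤s p) x (b ∷ A)
BlockConst-half⁺ p x b bc (c ∷ A') (c' ∷ A'') h h' with ∷-injectiveˡ h | ∷-injectiveˡ h'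
... | refl | refl rewrite ∨-identityʳ b = bc A' A'' (∷-injectiveʳ h) (∷-injectiveʳ h')

HasGeno-half : ∀ {i r} (p : i ≤ r) (x : Word (suc r)) {g} b →
  HasGeno (s≤s p) x g → HasGeno p (half b x) (half b g)
HasGeno-half p x b h A =
  (λ e → BlockConst-half⁻ p x b (proj₁ (h (b ∷ A)) e)) ,
  (λ c → proj₂ (h (b ∷ A)) (BlockConst-half⁺ p x b c))

HasGeno-halves : ∀ {i r} (p : i ≤ r) (x : Word (suc r)) {g} →
  HasGeno p (half false x) (half false g) → HasGeno p (half true x) (half true g) → HasGeno (s≤s p) x g
HasGeno-halves p x h₀ h₁ (false ∷ A) =
  (λ e → BlockConst-half⁺ p x false (proj₁ (h₀ A) e)) , (λ c → proj₂ (h₀ A) (BlockConst-half⁻ p x false c))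
HasGeno-halves p x h₀ h₁ (true ∷ A) =
  (λ e → BlockConst-half⁺ p x true (proj₁ (h₁ A) e)) , (λ c → proj₂ (h₁ A) (BlockConst-half⁻ p x true c))

HasGeno⇒Geno : ∀ {i r} (p : i ≤ r) x {g} → HasGeno p x g → Geno p x g
HasGeno⇒Geno z≤n x h =
  (λ e → BlockConst⇒Const (proj₁ (h []) e)) , (λ c → proj₂ (h []) (Const⇒BlockConst c))
HasGeno⇒Geno (s≤s p) x h =
  HasGeno⇒Geno p _ (HasGeno-half p x false h) , HasGeno⇒Geno p _ (HasGeno-half p x true h)

Geno⇒HasGeno : ∀ {i r} (p : i ≤ r) x {g} → Geno p x g → HasGeno p x g
Geno⇒HasGeno z≤n x (g⇒c , c⇒g) [] =
  (λ e → Const⇒BlockConst (g⇒c e)) , (λ bc → c⇒g (BlockConst⇒Const bc))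
Geno⇒HasGeno (s≤s p) x (geno₀ , geno₁) =
  HasGeno-halves p x (Geno⇒HasGeno p _ geno₀) (Geno⇒HasGeno p _ geno₁)

2^suc : ∀ n → 2 ^ suc n ≡ 2 ^ n + 2 ^ n
2^suc n = cong (2 ^ n +_) (+-identityʳ (2 ^ n))

[m+n]∸[o+p]≡[m∸o]+[n∸p] : ∀ {m n o p} → o ≤ m → p ≤ n → (m + n) ∸ (o + p) ≡ (m ∸ o) + (n ∸ p)
[m+n]∸[o+p]≡[m∸o]+[n∸p] {m} z≤n p≤n = +-∸-assoc m p≤n
[m+n]∸[o+p]≡[m∸o]+[n∸p] (s≤s o≤m) p≤n = [m+n]∸[o+p]≡[m∸o]+[n∸p] o≤m p≤n

^-∸-split : ∀ k {m n o p} → o ≤ m → p ≤ n → k ^ (m ∸ o) * k ^ (n ∸ p) ≡ k ^ ((m + n) ∸ (o + p))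
^-∸-split k {m} {n} {o} {p} o≤m p≤n =
  trans (sym (^-distribˡ-+-* k (m ∸ o) (n ∸ p))) (cong (k ^_) (sym ([m+n]∸[o+p]≡[m∸o]+[n∸p] o≤m p≤n)))

2s≤c⇒s≤c : ∀ s {c} → 2 * s ≤ c → s ≤ c
2s≤c⇒s≤c s 2s≤c = ≤-trans (m≤m+n s (s + 0)) 2s≤c

2s≤c⇒s≤c∸s : ∀ s {c} → 2 * s ≤ c → s ≤ c ∸ s
2s≤c⇒s≤c∸s s {c} 2s≤c = m+n≤o⇒m≤o∸n s (subst (λ k → s + k ≤ c) (+-identityʳ s) 2s≤c)

square∸2 : ∀ t → 2 ≤ t → (t ∸ 2) * t + (2 * (t ∸ 2) + 2) ≡ t * t ∸ 2
square∸2 (suc (suc m)) (s≤s (s≤s z≤n)) = identity m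
  where
  identity : ∀ m → m * suc (suc m) + (2 * m + 2) ≡ m + suc m * suc (suc m)
  identity = solve-∀

Const-count : ∀ {r} → Count _≗_ (Const {r}) 2
Const-count = Count-2 (enumeration const (λ _ _ → refl) (λ _ _ e → e ⊥) λ w c → w ⊥ , c)

Word-count : ∀ r → Count _≗_ (λ (_ : Word r) → ⊤) (2 ^ 2 ^ r)
Word-count zero = Count-cong-pred (λ _ → λ { [] → refl }) (λ _ → tt) Const-count
Word-count (suc r) =
  Count-cast (trans (sym (^-distribˡ-+-* 2 (2 ^ r) (2 ^ r))) (cong (2 ^_) (sym (2^suc r))))
    (Count-glue ≗⇒halves≗ halves≗⇒≗ (λ _ → tt , tt) (λ _ _ → tt) (Word-count r) (Word-count r))

DistinctConstHalves : ∀ {r} → Word (suc r) → Set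
DistinctConstHalves w = Const (half false w) × Const (half true w) × ¬ Const w

DistinctConstHalves-count : ∀ {r} → Count _≗_ (DistinctConstHalves {r}) 2
DistinctConstHalves-count =
  Count-2 (enumeration v (λ b → (λ _ → refl) , (λ _ → refl) , λ c → not-¬ refl (sym (c (true ∷ ⊥))))
                       (λ _ _ e → e (false ∷ ⊥)) cover)
  where
  v : Bool → Word (suc _)
  v b = glue (const b) (const (not b))
  cover : ∀ w → DistinctConstHalves w → Σ Bool λ b → w ≗ v b
  cover w (c₀ , c₁ , ¬c) =
    w (false ∷ ⊥) , halves≗⇒≗ c₀ λ S → trans (c₁ S) (¬-not λ e → ¬c (Const-halves c₀ c₁ (sym e)))

-- A non-constant word has a non-constant first half, or a constant first half and a
-- non-constant second half, or two distinct constant halves: (t - 2) t + 2 (t - 2) + 2 = t² - 2.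
¬Const-count : ∀ r → Count _≗_ (λ (w : Word r) → ¬ Const w) (2 ^ 2 ^ r ∸ 2)
¬Const-count zero = Count-0 λ ¬c → ¬c λ { [] → refl }
¬Const-count (suc r) =
  Count-cast count-identity
    (Count-+ ≗-sym split₁ first-half-¬Const proj₂ disjoint₁
      (Count-glue ≗⇒halves≗ halves≗⇒≗ (λ ¬c₀ → ¬c₀ , tt) (λ ¬c₀ _ → ¬c₀) (¬Const-count r) (Word-count r))
      (Count-+ ≗-sym split₂ (λ (c₀ , ¬c₁) → c₀ , λ c → ¬c₁ (Const-half true c)) (λ (c₀ , _ , ¬c) → c₀ , ¬c)
         disjoint₂
         (Count-glue ≗⇒halves≗ halves≗⇒≗ (λ c → c) _,_ Const-count (¬Const-count r))
         DistinctConstHalves-count))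
  where
  split₁ : ∀ {w : Word (suc r)} → ¬ Const w → ¬ Const (half false w) ⊎ (Const (half false w) × ¬ Const w)
  split₁ {w} ¬c with Const? (half false w)
  ... | yes c₀ = inj₂ (c₀ , ¬c)
  ... | no ¬c₀ = inj₁ ¬c₀
  first-half-¬Const : ∀ {w : Word (suc r)} → ¬ Const (half false w) → ¬ Const w
  first-half-¬Const ¬c₀ c = ¬c₀ (Const-half false c)
  disjoint₁ : ∀ {a b : Word (suc r)} → ¬ Const (half false a) → Const (half false b) × ¬ Const b → ¬ a ≗ b
  disjoint₁ ¬c₀ (c₀ , _) e = ¬c₀ (Const-resp-≗ (proj₁ (≗⇒halves≗ e)) c₀)
  split₂ : ∀ {w : Word (suc r)} → Const (half false w) × ¬ Const w →
    (Const (half false w) × ¬ Const (half true w)) ⊎ DistinctConstHalves w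
  split₂ {w} (c₀ , ¬c) with Const? (half true w)
  ... | yes c₁ = inj₂ (c₀ , c₁ , ¬c)
  ... | no ¬c₁ = inj₁ (c₀ , ¬c₁)
  disjoint₂ : ∀ {a b : Word (suc r)} → Const (half false a) × ¬ Const (half true a) →
    DistinctConstHalves b → ¬ a ≗ b
  disjoint₂ (_ , ¬c₁) (_ , c₁ , _) e = ¬c₁ (Const-resp-≗ (proj₂ (≗⇒halves≗ e)) c₁)
  t = 2 ^ 2 ^ r
  count-identity : (t ∸ 2) * t + (2 * (t ∸ 2) + 2) ≡ 2 ^ 2 ^ suc r ∸ 2
  count-identity = begin
    (t ∸ 2) * t + (2 * (t ∸ 2) + 2) ≡⟨ square∸2 t (^-monoʳ-≤ 2 (m^n>0 2 r)) ⟩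
    t * t ∸ 2                       ≡⟨ cong (_∸ 2) (sym (^-distribˡ-+-* 2 (2 ^ r) (2 ^ r))) ⟩
    2 ^ (2 ^ r + 2 ^ r) ∸ 2         ≡⟨ cong (λ e → 2 ^ e ∸ 2) (sym (2^suc r)) ⟩
    2 ^ 2 ^ suc r ∸ 2               ∎

Count-≗⇒Cell₀ : ∀ {r} {P : Word r → Set} {n} → (∀ {a} → P a → ¬ Const a) →
  Count _≗_ P n → Count (Cell z≤n) P n
Count-≗⇒Cell₀ ¬const =
  Count-cong (λ Pa → Pa) (λ Pa → Pa)
    (λ _ _ e → inj₁ (≗-sym e)) (λ Pa _ c → ≗-sym (Cell₀-¬Const (¬const Pa) c))

-- Sizes and numbers of cells

Cell-count : ∀ {i r} (p : i ≤ r) x {g} → Geno p x g → Count _≗_ (Cell p x) (2 ^ card g)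
Cell-count z≤n x {g} (g⇒c , c⇒g) with g []
... | true  = Count-cong-pred (λ c → Cell₀-Const c (g⇒c refl)) (λ c → inj₂ (g⇒c refl , c)) Const-count
... | false = Count-1 x (inj₁ λ _ → refl) λ { (inj₁ e) → e ; (inj₂ (c , _)) → ⊥-elim (false≢true (c⇒g c)) }
Cell-count (s≤s p) x {g} (geno₀ , geno₁) =
  Count-cast (sym (^-distribˡ-+-* 2 (card (half false g)) (card (half true g))))
    (Count-glue ≗⇒halves≗ halves≗⇒≗ (λ c → c) _,_ (Cell-count p _ geno₀) (Cell-count p _ geno₁))

card≤2^ : ∀ {i} (g : Genotype i) → card g ≤ 2 ^ i
card≤2^ {zero} g with g []
... | true  = ≤-refl
... | false = z≤n
card≤2^ {suc i} g =
  subst (card g ≤_) (sym (2^suc i)) (+-mono-≤ (card≤2^ (half false g)) (card≤2^ (half true g)))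

Geno-count : ∀ {i r} (p : i ≤ r) (g : Genotype i) →
  Count (Cell p) (λ x → Geno p x g) ((2 ^ 2 ^ (r ∸ i) ∸ 2) ^ (2 ^ i ∸ card g))
Geno-count z≤n g with g []
... | true  = Count-1 (const false) ((λ _ _ → refl) , λ _ → refl) λ (g⇒c , _) → inj₂ (g⇒c refl , λ _ → refl)
... | false = Count-cast (sym (*-identityʳ _))
  (Count-cong-pred (λ (_ , c⇒g) c → false≢true (c⇒g c)) (λ ¬c → (λ ()) , λ c → ⊥-elim (¬c c))
    (Count-≗⇒Cell₀ (λ ¬c → ¬c) (¬Const-count _)))
Geno-count {suc i} {suc r} (s≤s p) g =
  Count-cast (trans (^-∸-split n (card≤2^ (half false g)) (card≤2^ (half true g)))
                    (cong (λ e → n ^ (e ∸ card g)) (sym (2^suc i))))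
    (Count-glue (λ c → c) _,_ (λ c → c) _,_ (Geno-count p (half false g)) (Geno-count p (half true g)))
  where n = 2 ^ 2 ^ (r ∸ i) ∸ 2

card-mono : ∀ {i} {g' g : Genotype i} → g' ⊆g g → card g' ≤ card g
card-mono {zero} {g'} {g} g'⊆g with g' [] in e | g [] in e'
... | false | _     = z≤n
... | true  | true  = ≤-refl
... | true  | false = ⊥-elim (false≢true (trans (sym e') (g'⊆g [] e)))
card-mono {suc i} g'⊆g =
  +-mono-≤ (card-mono λ A → g'⊆g (false ∷ A)) (card-mono λ A → g'⊆g (true ∷ A))

card-consol : ∀ {j} (g : Genotype (suc j)) → 2 * card (consol g) ≤ card g
card-consol {zero} g with g (false ∷ []) | g (true ∷ [])
... | false | _     = z≤n
... | true  | false = z≤n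
... | true  | true  = ≤-refl
card-consol {suc j} g =
  subst (_≤ card g) (sym (*-distribˡ-+ 2 (card (consol (half false g))) (card (consol (half true g)))))
    (+-mono-≤ (card-consol (half false g)) (card-consol (half true g)))

card₀-true : ∀ (h : Genotype 0) → h [] ≡ true → card h ≡ 1
card₀-true h = cong (λ b → if b then 1 else 0)

card₀-false : ∀ (h : Genotype 0) → h [] ≢ true → card h ≡ 0
card₀-false h ¬e = cong (λ b → if b then 1 else 0) (¬-not ¬e)

card₁-consol-true : ∀ (g : Genotype 1) → consol g [] ≡ true → card g ≡ 2
card₁-consol-true g e =
  cong₂ _+_ (card₀-true (half false g) (∧-conicalˡ _ _ e)) (card₀-true (half true g) (∧-conicalʳ _ _ e))

const-child⇒const-halves : ∀ {r} (x : Word (suc r)) {y} → Cell (s≤s z≤n) x y → Const y →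
  Const (half false x) × Const (half true x)
const-child⇒const-halves x (c₀ , c₁) cy =
  Cell₀-Const (Cell-sym z≤n c₀) (Const-half false cy) , Cell₀-Const (Cell-sym z≤n c₁) (Const-half true cy)

Geno-child⊆consol : ∀ {j r} (p : suc j ≤ r) (q : j ≤ r) {x y g g'} →
  Geno p x g → Cell p x y → Geno q y g' → g' ⊆g consol g
Geno-child⊆consol (s≤s z≤n) z≤n {x} ((_ , ⇒g₀) , (_ , ⇒g₁)) c (g'⇒c , _) [] e =
  let c₀ , c₁ = const-child⇒const-halves x c (g'⇒c e) in cong₂ _∧_ (⇒g₀ c₀) (⇒g₁ c₁)
Geno-child⊆consol (s≤s p) (s≤s q) (geno₀ , _) (c₀ , _) (geno'₀ , _) (false ∷ A) =
  Geno-child⊆consol p q geno₀ c₀ geno'₀ A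
Geno-child⊆consol (s≤s p) (s≤s q) (_ , geno₁) (_ , c₁) (_ , geno'₁) (true ∷ A) =
  Geno-child⊆consol p q geno₁ c₁ geno'₁ A

-- Children

-- A constant child has genotype {∅}, which lies in g* by Geno-child⊆consol.
child₁-¬Const : ∀ {r} (x : Word (suc r)) g {y} → Geno (s≤s (z≤n {r})) x g → consol g [] ≢ true →
  Cell (s≤s z≤n) x y → ¬ Const y
child₁-¬Const x g {y} geno ¬e c cy =
  ¬e (Geno-child⊆consol (s≤s z≤n) z≤n {x} {y} {g} {const true} geno c ((λ _ → cy) , λ _ → refl) [] refl)

module _ {r} (x : Word (suc r)) (c₀ : Const (half false x)) (c₁ : Const (half true x)) where

  Cell₁⇒const-halves : ∀ {y} → Cell (s≤s (z≤n {r})) x y → Const (half false y) × Const (half true y)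
  Cell₁⇒const-halves (d₀ , d₁) = Cell₀-Const d₀ c₀ , Cell₀-Const d₁ c₁

  const-halves⇒Cell₁ : ∀ {y} → Const (half false y) → Const (half true y) → Cell (s≤s (z≤n {r})) x y
  const-halves⇒Cell₁ d₀ d₁ = inj₂ (c₀ , d₀) , inj₂ (c₁ , d₁)

  const-children-count : Count (Cell z≤n) (λ y → Cell (s≤s (z≤n {r})) x y × Const y) 1
  const-children-count =
    Count-1 (const false) (const-halves⇒Cell₁ {const false} (λ _ → refl) (λ _ → refl) , λ _ → refl)
      λ (_ , cy) → inj₂ (cy , λ _ → refl)

  ¬const-children-count : Count (Cell z≤n) (λ y → Cell (s≤s (z≤n {r})) x y × ¬ Const y) 2
  ¬const-children-count =
    Count-≗⇒Cell₀ proj₂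
      (Count-cong-pred (λ {y} (c , ¬cy) → let d₀ , d₁ = Cell₁⇒const-halves {y} c in d₀ , d₁ , ¬cy)
                       (λ {y} (d₀ , d₁ , ¬cy) → const-halves⇒Cell₁ {y} d₀ d₁ , ¬cy)
                       DistinctConstHalves-count)

  children-count-const-halves : Count (Cell z≤n) (Cell (s≤s (z≤n {r})) x) 3
  children-count-const-halves =
    Count-+ (Cell-sym z≤n) split proj₁ proj₁
      (λ {a} {b} (_ , ca) (_ , ¬cb) c → ¬cb (Cell₀-Const {y = a} {b} c ca))
      const-children-count ¬const-children-count
    where
    split : ∀ {y} → Cell (s≤s (z≤n {r})) x y →
      (Cell (s≤s z≤n) x y × Const y) ⊎ (Cell (s≤s z≤n) x y × ¬ Const y)
    split {y} c with Const? y
    ... | yes cy = inj₁ (c , cy)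
    ... | no ¬cy = inj₂ (c , ¬cy)

2^[c∸s∸t]-cong : ∀ {c c' s s' t t'} → c ≡ c' → s ≡ s' → t ≡ t' → 2 ^ (c ∸ s ∸ t) ≡ 2 ^ (c' ∸ s' ∸ t')
2^[c∸s∸t]-cong refl refl refl = refl

children-number : ℕ → ℕ → ℕ
children-number c s = 2 ^ (c ∸ 2 * s) * 3 ^ s

children-count₁ : ∀ {r} (x : Word (suc r)) {g} → Geno (s≤s (z≤n {r})) x g →
  Count (Cell z≤n) (Cell (s≤s z≤n) x) (children-number (card g) (card (consol g)))
children-count₁ x {g} geno@((g⇒c₀ , _) , (g⇒c₁ , _)) with consol g [] ≟ true
... | yes e = Count-cast (sym (cong₂ children-number (card₁-consol-true g e) (card₀-true (consol g) e))) $
  children-count-const-halves x (g⇒c₀ (∧-conicalˡ _ _ e)) (g⇒c₁ (∧-conicalʳ _ _ e))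
... | no ¬e = Count-cast (sym (cong (children-number (card g)) (card₀-false (consol g) ¬e))) $
  Count-≗⇒Cell₀ (child₁-¬Const x g geno ¬e)
    (Count-cast (sym (*-identityʳ _)) (Cell-count (s≤s z≤n) x {g} geno))

genotype-children-count₁ : ∀ {r} (x : Word (suc r)) {g g'} → Geno (s≤s (z≤n {r})) x g → g' ⊆g consol g →
  Count (Cell z≤n) (λ y → Cell (s≤s z≤n) x y × Geno z≤n y g') (2 ^ (card g ∸ card (consol g) ∸ card g'))
genotype-children-count₁ x {g} {g'} geno@((g⇒c₀ , _) , (g⇒c₁ , _)) g'⊆g*
  with consol g [] ≟ true | g' [] ≟ true
... | yes e | yes e' =
  Count-cast (sym (2^[c∸s∸t]-cong (card₁-consol-true g e) (card₀-true (consol g) e) (card₀-true g' e'))) $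
  Count-cong-pred (λ (c , (g'⇒c , _)) → c , g'⇒c e') (λ (c , cy) → c , (λ _ → cy) , (λ _ → e'))
    (const-children-count x (g⇒c₀ (∧-conicalˡ _ _ e)) (g⇒c₁ (∧-conicalʳ _ _ e)))
... | yes e | no ¬e' =
  Count-cast (sym (2^[c∸s∸t]-cong (card₁-consol-true g e) (card₀-true (consol g) e) (card₀-false g' ¬e'))) $
  Count-cong-pred (λ (c , (_ , c⇒g')) → c , λ cy → ¬e' (c⇒g' cy))
    (λ (c , ¬cy) → c , (λ e' → ⊥-elim (¬e' e')) , (λ cy → ⊥-elim (¬cy cy)))
    (¬const-children-count x (g⇒c₀ (∧-conicalˡ _ _ e)) (g⇒c₁ (∧-conicalʳ _ _ e)))
... | no ¬e | yes e' = ⊥-elim (¬e (g'⊆g* [] e'))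
... | no ¬e | no ¬e' =
  Count-cast (sym (2^[c∸s∸t]-cong refl (card₀-false (consol g) ¬e) (card₀-false g' ¬e'))) $
  Count-cong-pred proj₁
    (λ c → c , (λ e' → ⊥-elim (¬e' e')) , (λ cy → ⊥-elim (child₁-¬Const x g geno ¬e c cy)))
    (Count-≗⇒Cell₀ (child₁-¬Const x g geno ¬e) (Cell-count (s≤s z≤n) x {g} geno))

children-number-+ : ∀ {c₀ c₁ s₀ s₁} → 2 * s₀ ≤ c₀ → 2 * s₁ ≤ c₁ →
  children-number c₀ s₀ * children-number c₁ s₁ ≡ children-number (c₀ + c₁) (s₀ + s₁)
children-number-+ {c₀} {c₁} {s₀} {s₁} h₀ h₁ = begin
  (2 ^ (c₀ ∸ 2 * s₀) * 3 ^ s₀) * (2 ^ (c₁ ∸ 2 * s₁) * 3 ^ s₁)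
    ≡⟨ interchange *-commutativeSemigroup (2 ^ (c₀ ∸ 2 * s₀)) (3 ^ s₀) (2 ^ (c₁ ∸ 2 * s₁)) (3 ^ s₁) ⟩
  (2 ^ (c₀ ∸ 2 * s₀) * 2 ^ (c₁ ∸ 2 * s₁)) * (3 ^ s₀ * 3 ^ s₁)
    ≡⟨ cong₂ _*_ (^-∸-split 2 h₀ h₁) (sym (^-distribˡ-+-* 3 s₀ s₁)) ⟩
  2 ^ ((c₀ + c₁) ∸ (2 * s₀ + 2 * s₁)) * 3 ^ (s₀ + s₁)
    ≡⟨ cong (λ k → 2 ^ ((c₀ + c₁) ∸ k) * 3 ^ (s₀ + s₁)) (sym (*-distribˡ-+ 2 s₀ s₁)) ⟩
  children-number (c₀ + c₁) (s₀ + s₁) ∎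

2^[c∸s∸t]-+ : ∀ {c₀ c₁ s₀ s₁ t₀ t₁} → 2 * s₀ ≤ c₀ → 2 * s₁ ≤ c₁ → t₀ ≤ s₀ → t₁ ≤ s₁ →
  2 ^ (c₀ ∸ s₀ ∸ t₀) * 2 ^ (c₁ ∸ s₁ ∸ t₁) ≡ 2 ^ ((c₀ + c₁) ∸ (s₀ + s₁) ∸ (t₀ + t₁))
2^[c∸s∸t]-+ {s₀ = s₀} {s₁} {t₀} {t₁} h₀ h₁ t₀≤s₀ t₁≤s₁ =
  trans (^-∸-split 2 (≤-trans t₀≤s₀ (2s≤c⇒s≤c∸s s₀ h₀)) (≤-trans t₁≤s₁ (2s≤c⇒s≤c∸s s₁ h₁)))
        (cong (λ k → 2 ^ (k ∸ (t₀ + t₁)))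
              (sym ([m+n]∸[o+p]≡[m∸o]+[n∸p] (2s≤c⇒s≤c s₀ h₀) (2s≤c⇒s≤c s₁ h₁))))

children-count : ∀ {j r} (p : suc j ≤ r) (q : j ≤ r) x {g} → Geno p x g →
  Count (Cell q) (Cell p x) (children-number (card g) (card (consol g)))
children-count (s≤s z≤n) z≤n x {g} geno = children-count₁ x {g} geno
children-count (s≤s p) (s≤s q) x {g} (geno₀ , geno₁) =
  Count-cast (children-number-+ {card g₀} {card g₁} {card (consol g₀)} {card (consol g₁)}
                                (card-consol g₀) (card-consol g₁))
    (Count-glue (λ c → c) _,_ (λ c → c) _,_
                (children-count p q _ {g₀} geno₀) (children-count p q _ {g₁} geno₁))
  where
  g₀ = half false g
  g₁ = half true g

genotype-children-count : ∀ {j r} (p : suc j ≤ r) (q : j ≤ r) x {g g'} → Geno p x g → g' ⊆g consol g →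
  Count (Cell q) (λ y → Cell p x y × Geno q y g') (2 ^ (card g ∸ card (consol g) ∸ card g'))
genotype-children-count (s≤s z≤n) z≤n x {g} geno g'⊆g* = genotype-children-count₁ x {g} geno g'⊆g*
genotype-children-count (s≤s p) (s≤s q) x {g} {g'} (geno₀ , geno₁) g'⊆g* =
  Count-cast (2^[c∸s∸t]-+ {card g₀} {card g₁} {card (consol g₀)} {card (consol g₁)}
                          {card (half false g')} {card (half true g')} (card-consol g₀) (card-consol g₁)
                          (card-mono g'₀⊆g₀*) (card-mono g'₁⊆g₁*))
    (Count-glue (λ c → c) _,_ (λ ((c₀ , c₁) , (k₀ , k₁)) → (c₀ , k₀) , (c₁ , k₁))
                (λ (c₀ , k₀) (c₁ , k₁) → (c₀ , c₁) , (k₀ , k₁))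
                (genotype-children-count p q _ {g₀} geno₀ g'₀⊆g₀*)
                (genotype-children-count p q _ {g₁} geno₁ g'₁⊆g₁*))
  where
  g₀ = half false g
  g₁ = half true g
  g'₀⊆g₀* : half false g' ⊆g consol g₀
  g'₀⊆g₀* A = g'⊆g* (false ∷ A)
  g'₁⊆g₁* : half true g' ⊆g consol g₁
  g'₁⊆g₁* A = g'⊆g* (true ∷ A)

cell-size : ∀ {i r} (p : i ≤ r) x {g} → HasGeno p x g → HasCount _≗_ (InCell p x) (2 ^ card g)
cell-size p x hx = Count⇒HasCount $
  Count-cong-pred (InCell⇒Cell p x _) (Cell⇒InCell p x _) (Cell-count p x (HasGeno⇒Geno p x hx))

cells-of-genotype : ∀ {i r} (p : i ≤ r) g →
  HasCount (SameCell p) (λ x → HasGeno p x g) ((2 ^ 2 ^ (r ∸ i) ∸ 2) ^ (2 ^ i ∸ card g))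
cells-of-genotype p g = Count⇒HasCount $
  Count-cong (HasGeno⇒Geno p _) (Geno⇒HasGeno p _) (λ _ _ → Cell⇒SameCell p) (λ _ _ → SameCell⇒Cell p)
    (Geno-count p g)

child-genotype⊆consol : ∀ {j r} (p : suc j ≤ r) (q : j ≤ r) x y {g g'} →
  HasGeno p x g → IsChild p q x y → HasGeno q y g' → (g' ⊆g consol g) × (2 * card g' ≤ card g)
child-genotype⊆consol p q x y {g} hx child hy =
  g'⊆g* , ≤-trans (*-monoʳ-≤ 2 (card-mono g'⊆g*)) (card-consol g)
  where
  g'⊆g* = Geno-child⊆consol p q (HasGeno⇒Geno p x hx) (IsChild⇒Cell p q child) (HasGeno⇒Geno q y hy)

children-of-genotype : ∀ {j r} (p : suc j ≤ r) (q : j ≤ r) x {g g'} → HasGeno p x g → g' ⊆g consol g →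
  HasCount (SameCell q) (λ y → IsChild p q x y × HasGeno q y g') (2 ^ (card g ∸ card (consol g) ∸ card g'))
children-of-genotype p q x hx g'⊆g* = Count⇒HasCount $
  Count-cong (λ (c , k) → IsChild⇒Cell p q c , HasGeno⇒Geno q _ k)
             (λ (c , k) → Cell⇒IsChild p q c , Geno⇒HasGeno q _ k)
             (λ _ _ → Cell⇒SameCell q) (λ _ _ → SameCell⇒Cell q)
    (genotype-children-count p q x (HasGeno⇒Geno p x hx) g'⊆g*)

number-of-children : ∀ {j r} (p : suc j ≤ r) (q : j ≤ r) x {g} → HasGeno p x g →
  HasCount (SameCell q) (IsChild p q x) (children-number (card g) (card (consol g)))
number-of-children p q x hx = Count⇒HasCount $
  Count-cong (IsChild⇒Cell p q) (Cell⇒IsChild p q) (λ _ _ → Cell⇒SameCell q) (λ _ _ → SameCell⇒Cell q)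
    (children-count p q x (HasGeno⇒Geno p x hx))

lemma10p5 : (r : ℕ) → 1 ≤ r →
    -- (a) |C| = 2^{|g(C)|}
    ((i : ℕ) (p : i ≤ r) (x : Word r) (g : Genotype i) → HasGeno p x g →
      HasCount _≗_ (InCell p x) (2 ^ card g))
  × -- (b) number of level-i cells with genotype g
    ((i : ℕ) (p : i ≤ r) (g : Genotype i) →
      HasCount (SameCell p) (λ x → HasGeno p x g) ((2 ^ (2 ^ (r ∸ i)) ∸ 2) ^ (2 ^ i ∸ card g)))
  × -- (c) g(C') ⊆ g* and |g(C')| ≤ |g(C)|/2
    ((j : ℕ) (p : suc j ≤ r) (q : j ≤ r) (x y : Word r) (g : Genotype (suc j)) (g' : Genotype j) →
      HasGeno p x g → IsChild p q x y → HasGeno q y g' →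
      (g' ⊆g consol g) × (2 * card g' ≤ card g))
  × -- (d) number of children with genotype g' ⊆ g*
    ((j : ℕ) (p : suc j ≤ r) (q : j ≤ r) (x : Word r) (g : Genotype (suc j)) (g' : Genotype j) →
      HasGeno p x g → g' ⊆g consol g →
      HasCount (SameCell q) (λ y → IsChild p q x y × HasGeno q y g')
        (2 ^ (card g ∸ card (consol g) ∸ card g')))
  × -- (e) number of children
    ((j : ℕ) (p : suc j ≤ r) (q : j ≤ r) (x : Word r) (g : Genotype (suc j)) →
      HasGeno p x g →
      HasCount (SameCell q) (IsChild p q x)
        (2 ^ (card g ∸ 2 * card (consol g)) * 3 ^ card (consol g)))
lemma10p5 r _ =
    (λ i p x g → cell-size p x)
  , (λ i p g → cells-of-genotype p g)
  , (λ j p q x y g g' → child-genotype⊆consol p q x y)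
  , (λ j p q x g g' → children-of-genotype p q x)
  , (λ j p q x g → number-of-children p q x)
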